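{- Let $\star:\{0,1\}\times\{0,1\}\to\{0,1\}$ be any map and $u$ a $0$-$1$ sequence indexed by $\mathbb{N}$. Then $\widehat G_{(u,\star)}=\widehat G_{(u\dot+\mathbf1,\overline\star)}$ and $\mathrm{age}(\widehat G_{(u,\star)})=\mathrm{age}(\widehat G_{(u,\star^d)})$.
   Context: $\dot+$ is addition mod $2$; $u\dot+\mathbf1$ is the sequence $n\mapsto u(n)\dot+1$; $\star^d$ is defined by $i\star^d j=j\star i$ and $\overline\star$ by $i\,\overline\star\, j=(i\dot+1)\star(j\dot+1)$. $G_{(u,\star)}$ is the labelled graph on $\mathbb{N}\times\mathbb{N}$, $(i,n)$ labelled $u(n)$, with $(i,n)\sim(i,m)$ iff $|n-m|=1$ and, for $i<j$, $(i,n)\sim(j,m)$ iff $u(n)\star u(m)=1$; $\widehat G_{(u,\star)}$ is the underlying unlabelled graph. The age of a graph is the class of finite graphs isomorphic to its induced subgraphs. -}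

module Defs where

open import Data.Bool using (Bool; true; false; not)
open import Data.Nat using (ℕ; suc; _<_)
open import Data.Fin using (Fin)
open import Data.Product using (_×_; _,_; Σ)
open import Data.Sum using (_⊎_)
open import Relation.Binary.PropositionalEquality using (_≡_)
open import Function using (Injective; _⇔_)

-- {0,1} is represented by Bool (0 = false, 1 = true).
-- A binary operation ⋆ : {0,1} × {0,1} → {0,1} (curried).
BinOp : Set
BinOp = Bool → Bool → Bool

_∔𝟏 : (ℕ → Bool) → (ℕ → Bool)
(u ∔𝟏) n = not (u n)

_ᵈ : BinOp → BinOp
(⋆ ᵈ) i j = ⋆ j i

bar : BinOp → BinOp
bar ⋆ i j = ⋆ (not i) (not j)

Dist1 : ℕ → ℕ → Set
Dist1 n m = (n ≡ suc m) ⊎ (m ≡ suc n)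

V : Set
V = ℕ × ℕ

label : (ℕ → Bool) → V → Bool
label u (i , n) = u n

Ĝ : (ℕ → Bool) → BinOp → V → V → Set
Ĝ u ⋆ (i , n) (j , m) =
  ((i ≡ j) × Dist1 n m)
  ⊎ ((i < j) × (⋆ (u n) (u m) ≡ true))
  ⊎ ((j < i) × (⋆ (u m) (u n) ≡ true))

record FinGraph : Set where
  field
    size  : ℕ
    edge  : Fin size → Fin size → Bool
    sym   : ∀ a b → edge a b ≡ edge b a
    irrefl : ∀ a → edge a a ≡ false

-- H belongs to the age of the graph (V, E): H is isomorphic to an induced
-- subgraph, i.e. there is an injective map f from the vertices of H into V
-- with a ~_H b iff f a ~ f b.
InAge : (V → V → Set) → FinGraph → Set
InAge E H =
  Σ (Fin (FinGraph.size H) → V) λ f →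
    Injective _≡_ _≡_ f ×
    (∀ a b → (FinGraph.edge H a b ≡ true) ⇔ E (f a) (f b))

-- Both graphs only depend on the labels through the value ⋆ (u n) (u m), which is unchanged when
-- u and ⋆ are both complemented, so the first identity holds edge by edge. For the age, a finite
-- induced subgraph occupies only columns i ≤ N for some N; reversing these columns (i ↦ N ∸ i)
-- swaps the roles of the smaller and larger column, which is exactly what replacing ⋆ by ⋆ᵈ does.
module Submission where

open import Defs
open import Data.Bool using (Bool; true)
open import Data.Bool.Properties using (not-involutive)
open import Data.Nat using (ℕ; _≤_; _∸_)
open import Data.Nat.Properties using (∸-monoʳ-<; ∸-cancelʳ-<; ∸-cancelˡ-≡)
open import Data.Fin using (Fin)
open import Data.List using (tabulate)
open import Data.List.Extrema.Nat using (max; xs≤max)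
open import Data.List.Membership.Propositional.Properties using (∈-tabulate⁺)
import Data.List.Relation.Unary.All as All
open import Data.Product using (_×_; _,_; proj₁; proj₂)
open import Data.Sum using (inj₁; inj₂)
open import Relation.Binary.PropositionalEquality using (_≡_; sym; trans; cong; cong₂)
open import Function using (_⇔_; mk⇔; Injective)
import Function.Properties.Equivalence as ⇔

Ĝ-cong : ∀ {u v : ℕ → Bool} {⋆ ◇ : BinOp} →
  (∀ n m → ⋆ (u n) (u m) ≡ ◇ (v n) (v m)) → ∀ x y → Ĝ u ⋆ x y ⇔ Ĝ v ◇ x y
Ĝ-cong {u} {v} {⋆} {◇} same (i , n) (j , m) = mk⇔ to from
  where
  to : Ĝ u ⋆ (i , n) (j , m) → Ĝ v ◇ (i , n) (j , m)
  to (inj₁ p)              = inj₁ p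
  to (inj₂ (inj₁ (p , q))) = inj₂ (inj₁ (p , trans (sym (same n m)) q))
  to (inj₂ (inj₂ (p , q))) = inj₂ (inj₂ (p , trans (sym (same m n)) q))
  from : Ĝ v ◇ (i , n) (j , m) → Ĝ u ⋆ (i , n) (j , m)
  from (inj₁ p)              = inj₁ p
  from (inj₂ (inj₁ (p , q))) = inj₂ (inj₁ (p , trans (same n m) q))
  from (inj₂ (inj₂ (p , q))) = inj₂ (inj₂ (p , trans (same m n) q))

bar-∔𝟏 : ∀ (⋆ : BinOp) u n m → ⋆ (u n) (u m) ≡ bar ⋆ ((u ∔𝟏) n) ((u ∔𝟏) m)
bar-∔𝟏 ⋆ u n m = sym (cong₂ ⋆ (not-involutive (u n)) (not-involutive (u m)))

Ĝ-reverse : ∀ u (⋆ : BinOp) N {i j} n m → i ≤ N → j ≤ N →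
  Ĝ u ⋆ (i , n) (j , m) ⇔ Ĝ u (⋆ ᵈ) (N ∸ i , n) (N ∸ j , m)
Ĝ-reverse u ⋆ N {i} {j} n m i≤N j≤N = mk⇔ to from
  where
  to : Ĝ u ⋆ (i , n) (j , m) → Ĝ u (⋆ ᵈ) (N ∸ i , n) (N ∸ j , m)
  to (inj₁ (p , q))        = inj₁ (cong (N ∸_) p , q)
  to (inj₂ (inj₁ (p , q))) = inj₂ (inj₂ (∸-monoʳ-< p j≤N , q))
  to (inj₂ (inj₂ (p , q))) = inj₂ (inj₁ (∸-monoʳ-< p i≤N , q))
  from : Ĝ u (⋆ ᵈ) (N ∸ i , n) (N ∸ j , m) → Ĝ u ⋆ (i , n) (j , m)
  from (inj₁ (p , q))        = inj₁ (∸-cancelˡ-≡ i≤N j≤N p , q)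
  from (inj₂ (inj₁ (p , q))) = inj₂ (inj₂ (∸-cancelʳ-< p , q))
  from (inj₂ (inj₂ (p , q))) = inj₂ (inj₁ (∸-cancelʳ-< p , q))

≤-maxOf : ∀ {k} (g : Fin k → ℕ) a → g a ≤ max 0 (tabulate g)
≤-maxOf g a = All.lookup (xs≤max 0 (tabulate g)) (∈-tabulate⁺ a)

InAge-transport : ∀ {E E' : V → V → Set} H (f : Fin (FinGraph.size H) → V) →
  Injective _≡_ _≡_ f →
  (∀ a b → (FinGraph.edge H a b ≡ true) ⇔ E (f a) (f b)) →
  (g : V → V) →
  (∀ a b → g (f a) ≡ g (f b) → f a ≡ f b) →
  (∀ a b → E (f a) (f b) ⇔ E' (g (f a)) (g (f b))) →
  InAge E' H
InAge-transport H f f-inj f-iso g g-inj g-iso =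
  (λ a → g (f a)) , (λ e → f-inj (g-inj _ _ e)) , (λ a b → ⇔.trans (f-iso a b) (g-iso a b))

InAge-dual : ∀ u (⋆ : BinOp) H → InAge (Ĝ u ⋆) H → InAge (Ĝ u (⋆ ᵈ)) H
InAge-dual u ⋆ H (f , f-inj , f-iso) =
  InAge-transport {Ĝ u ⋆} {Ĝ u (⋆ ᵈ)} H f f-inj f-iso reverse reverse-inj reverse-iso
  where
  N : ℕ
  N = max 0 (tabulate (λ a → proj₁ (f a)))
  reverse : V → V
  reverse (i , n) = N ∸ i , n
  column≤N : ∀ a → proj₁ (f a) ≤ N
  column≤N = ≤-maxOf (λ a → proj₁ (f a))
  reverse-inj : ∀ a b → reverse (f a) ≡ reverse (f b) → f a ≡ f b
  reverse-inj a b e =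
    cong₂ _,_ (∸-cancelˡ-≡ (column≤N a) (column≤N b) (cong proj₁ e)) (cong proj₂ e)
  reverse-iso : ∀ a b → Ĝ u ⋆ (f a) (f b) ⇔ Ĝ u (⋆ ᵈ) (reverse (f a)) (reverse (f b))
  reverse-iso a b = Ĝ-reverse u ⋆ N (proj₂ (f a)) (proj₂ (f b)) (column≤N a) (column≤N b)

lemma6 : (⋆ : Bool → Bool → Bool) (u : ℕ → Bool) →
    (∀ x y → Ĝ u ⋆ x y ⇔ Ĝ (u ∔𝟏) (bar ⋆) x y)
    × (∀ H → InAge (Ĝ u ⋆) H ⇔ InAge (Ĝ u (⋆ ᵈ)) H)
lemma6 ⋆ u = Ĝ-cong {⋆ = ⋆} {◇ = bar ⋆} (bar-∔𝟏 ⋆ u) , λ H → mk⇔ (InAge-dual u ⋆ H) (InAge-dual u (⋆ ᵈ) H)
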